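{- Let $G$ be a connected graph and $c$ a $t$-edge-coloring of $G$. Let $H$ be a representing graph of $c$ having a component $H_1$ such that $|V(H_1)|\ge or_1(H')$ for every representing graph $H'$ of $c$. If $H$ has at least two components, then $H_1$ has a bridge (an edge whose deletion disconnects $H_1$).
   Context: A $t$-edge-coloring of $G$ is a surjective map $E(G)\to\{1,\dots,t\}$. A representing graph of a $t$-edge-coloring $c$ is a spanning subgraph of $G$ with exactly $t$ edges whose edges have pairwise distinct colors (so it contains exactly one edge of each color). For a graph $H'$, $or_1(H')$ is the number of vertices of a largest component of $H'$. -}

module Defs where

open import Data.Nat using (ℕ; _≤_)
open import Data.Fin using (Fin)
open import Data.Fin.Subset using (Subset; _∈_; ∣_∣)
open import Data.Product using (Σ; ∃; _×_; _,_; proj₁; proj₂)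
open import Data.Sum using (_⊎_)
open import Relation.Binary.PropositionalEquality using (_≡_; _≢_)
open import Relation.Nullary using (¬_)

record Graph (n m : ℕ) : Set where
  field
    ends     : Fin m → Fin n × Fin n
    loopless : ∀ e → proj₁ (ends e) ≢ proj₂ (ends e)
    simple   : ∀ e f →
               ((proj₁ (ends e) ≡ proj₁ (ends f) × proj₂ (ends e) ≡ proj₂ (ends f)) ⊎
                (proj₁ (ends e) ≡ proj₂ (ends f) × proj₂ (ends e) ≡ proj₁ (ends f))) →
               e ≡ f
open Graph public

module _ {n m : ℕ} (G : Graph n m) where

  -- Reachability in the spanning subgraph of G whose edge set is given by
  -- the predicate P on edge indices.
  data Reach (P : Fin m → Set) : Fin n → Fin n → Set where
    here : ∀ {u} → Reach P u u
    fwd  : ∀ {u v} e → P e → proj₁ (ends G e) ≡ u → Reach P (proj₂ (ends G e)) v → Reach P u v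
    bwd  : ∀ {u v} e → P e → proj₂ (ends G e) ≡ u → Reach P (proj₁ (ends G e)) v → Reach P u v

  InS : Subset m → Fin m → Set
  InS S e = e ∈ S

  Connected : Set
  Connected = ∀ u v → Reach (λ _ → ⊤') u v
    where open import Data.Unit renaming (⊤ to ⊤')

  IsEdgeColoring : (t : ℕ) → (Fin m → Fin t) → Set
  IsEdgeColoring t c = ∀ i → ∃ λ e → c e ≡ i

  IsRepresenting : {t : ℕ} → (Fin m → Fin t) → Subset m → Set
  IsRepresenting {t} c S =
    ∣ S ∣ ≡ t × (∀ e f → e ∈ S → f ∈ S → c e ≡ c f → e ≡ f)

  IsComponent : Subset m → Subset n → Set
  IsComponent S C = ∃ λ r → ∀ v → (v ∈ C → Reach (InS S) r v) × (Reach (InS S) r v → v ∈ C)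

  AtLeastTwoComponents : Subset m → Set
  AtLeastTwoComponents S = ∃ λ u → ∃ λ v → ¬ Reach (InS S) u v

  HasBridge : Subset m → Subset n → Set
  HasBridge S C = ∃ λ e → e ∈ S × proj₁ (ends G e) ∈ C × proj₂ (ends G e) ∈ C ×
    (∃ λ x → ∃ λ y → x ∈ C × y ∈ C × ¬ Reach (λ f → f ∈ S × f ≢ e) x y)

-- Since G is connected and H₁ is not everything, some edge e of G leaves H₁;
-- e is not in H, and H has exactly one edge f of the colour of e (an injective
-- colouring of t edges by t colours is onto).  Exchanging f for e gives a new
-- representing graph H'.  If f were not a bridge of H₁ (either f lies outside
-- H₁, or its endpoints stay connected in H₁ − f), then H₁ would remain
-- connected in H' and together with the far endpoint of e it would lie in a
-- component of H' strictly larger than H₁, contradicting the maximality of H₁.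
module Submission where

open import Defs
open import Data.Nat using (ℕ; _≤_)
open import Data.Fin using (Fin)
open import Data.Fin.Subset using (Subset; ∣_∣)

open import Data.Nat using (zero; suc; _<_; _∸_)
open import Data.Nat.Properties using (<⇒≱; ≤-pred; <-≤-trans; ∸-monoʳ-<; m∸n≤m; m<n⇒0<n∸m; n<1+n)
open import Data.Fin using (zero; suc; _≟_)
open import Data.Fin.Properties using (any?; suc-injective)
open import Data.Fin.Subset using (inside; outside; _∈_; _∉_; _⊂_; ⁅_⁆; ⊤; ⊥)
open import Data.Fin.Subset.Properties
  using (_∈?_; ∣p∣≤n; ∣⊥∣≡0; ∉⊥; ∈⊤; ∣p∣≡n⇒p≡⊤; x∈⁅x⁆; x∈⁅y⁆⇒x≡y; p⊂q⇒∣p∣<∣q∣)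
open import Data.Vec using (_∷_; []; _[_]≔_; here; there)
open import Data.Vec.Properties using ([]≔-updates; []≔-minimal; []=-injective; []=⇒lookup; lookup⇒[]=; lookup∘update′)
open import Data.Product using (Σ; ∃; ∃₂; _×_; _,_; proj₁; proj₂)
open import Data.Sum using (_⊎_; inj₁; inj₂)
open import Data.Empty using (⊥-elim)
open import Relation.Nullary using (¬_; Dec; yes; no)
open import Relation.Nullary.Decidable using (_×-dec_; _⊎-dec_; ¬?; decidable-stable)
open import Relation.Binary.PropositionalEquality using (_≡_; _≢_; refl; sym; trans; cong; subst)

x∈p[x]≔inside : ∀ {k} (p : Subset k) (x : Fin k) → x ∈ p [ x ]≔ inside
x∈p[x]≔inside = []≔-updates

x∉p[x]≔outside : ∀ {k} (p : Subset k) (x : Fin k) → x ∉ p [ x ]≔ outside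
x∉p[x]≔outside p x x∈ with []=-injective ([]≔-updates p x) x∈
... | ()

x∈p∧x≢y⇒x∈p[y]≔s : ∀ {k} {p : Subset k} {x y} s → x ∈ p → x ≢ y → x ∈ p [ y ]≔ s
x∈p∧x≢y⇒x∈p[y]≔s {p = p} {x} {y} _ x∈p x≢y = []≔-minimal p x y x≢y x∈p

x∈p[y]≔s∧x≢y⇒x∈p : ∀ {k} {p : Subset k} {x y} s → x ∈ p [ y ]≔ s → x ≢ y → x ∈ p
x∈p[y]≔s∧x≢y⇒x∈p {p = p} {x} s x∈ x≢y =
  lookup⇒[]= x p (trans (sym (lookup∘update′ x≢y p s)) ([]=⇒lookup x∈))

∣p[x]≔inside∣≡1+∣p∣ : ∀ {k} (p : Subset k) x → x ∉ p → ∣ p [ x ]≔ inside ∣ ≡ suc ∣ p ∣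
∣p[x]≔inside∣≡1+∣p∣ (inside ∷ p)  zero    x∉p = ⊥-elim (x∉p here)
∣p[x]≔inside∣≡1+∣p∣ (outside ∷ p) zero    x∉p = refl
∣p[x]≔inside∣≡1+∣p∣ (inside ∷ p)  (suc x) x∉p = cong suc (∣p[x]≔inside∣≡1+∣p∣ p x (λ x∈p → x∉p (there x∈p)))
∣p[x]≔inside∣≡1+∣p∣ (outside ∷ p) (suc x) x∉p = ∣p[x]≔inside∣≡1+∣p∣ p x (λ x∈p → x∉p (there x∈p))

1+∣p[x]≔outside∣≡∣p∣ : ∀ {k} (p : Subset k) x → x ∈ p → suc ∣ p [ x ]≔ outside ∣ ≡ ∣ p ∣
1+∣p[x]≔outside∣≡∣p∣ (inside ∷ p)  zero    here        = refl
1+∣p[x]≔outside∣≡∣p∣ (inside ∷ p)  (suc x) (there x∈p) = cong suc (1+∣p[x]≔outside∣≡∣p∣ p x x∈p)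
1+∣p[x]≔outside∣≡∣p∣ (outside ∷ p) (suc x) (there x∈p) = 1+∣p[x]≔outside∣≡∣p∣ p x x∈p

InjectiveOn : ∀ {m t} → (Fin m → Fin t) → Subset m → Set
InjectiveOn c p = ∀ e f → e ∈ p → f ∈ p → c e ≡ c f → e ≡ f

injective-image : ∀ {m t} (c : Fin m → Fin t) (p : Subset m) → InjectiveOn c p →
  Σ (Subset t) λ I → (∀ {j} → j ∈ I → ∃ λ e → e ∈ p × c e ≡ j) × ∣ I ∣ ≡ ∣ p ∣
injective-image {t = t} c [] _ = ⊥ , (λ j∈⊥ → ⊥-elim (∉⊥ j∈⊥)) , ∣⊥∣≡0 t
injective-image c (s ∷ p) inj
  with injective-image (λ e → c (suc e)) p
         (λ e f e∈ f∈ ce≡cf → suc-injective (inj (suc e) (suc f) (there e∈) (there f∈) ce≡cf))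
injective-image c (outside ∷ p) inj | I , I⊆c[p] , ∣I∣≡∣p∣ =
  I , (λ j∈I → let e , e∈p , ce≡j = I⊆c[p] j∈I in suc e , there e∈p , ce≡j) , ∣I∣≡∣p∣
injective-image c (inside ∷ p) inj | I , I⊆c[p] , ∣I∣≡∣p∣ =
  I [ c zero ]≔ inside , ⊆c[p] , trans (∣p[x]≔inside∣≡1+∣p∣ I (c zero) c0∉I) (cong suc ∣I∣≡∣p∣)
  where
  c0∉I : c zero ∉ I
  c0∉I c0∈I with I⊆c[p] c0∈I
  ... | e , e∈p , ce≡c0 with inj (suc e) zero (there e∈p) here ce≡c0
  ... | ()
  ⊆c[p] : ∀ {j} → j ∈ I [ c zero ]≔ inside → ∃ λ e → e ∈ inside ∷ p × c e ≡ j
  ⊆c[p] {j} j∈ with j ≟ c zero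
  ... | yes j≡c0 = zero , here , sym j≡c0
  ... | no j≢c0 = let e , e∈p , ce≡j = I⊆c[p] (x∈p[y]≔s∧x≢y⇒x∈p inside j∈ j≢c0) in
                  suc e , there e∈p , ce≡j

exchange : ∀ {m} → Subset m → Fin m → Fin m → Subset m
exchange H f e = H [ f ]≔ outside [ e ]≔ inside

module _ {m} {H : Subset m} {f e : Fin m} where

  e∈exchange : e ∈ exchange H f e
  e∈exchange = x∈p[x]≔inside _ e

  ∈-exchange⁺ : ∀ {g} → g ∈ H × g ≢ f → g ∈ exchange H f e
  ∈-exchange⁺ {g} (g∈H , g≢f) with g ≟ e
  ... | yes refl = e∈exchange
  ... | no g≢e = x∈p∧x≢y⇒x∈p[y]≔s inside (x∈p∧x≢y⇒x∈p[y]≔s outside g∈H g≢f) g≢e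

  ∈-exchange⁻ : ∀ {g} → g ∈ exchange H f e → g ≡ e ⊎ (g ∈ H × g ≢ f)
  ∈-exchange⁻ {g} g∈ with g ≟ e
  ... | yes g≡e = inj₁ g≡e
  ... | no g≢e with g ≟ f
  ...   | yes refl = ⊥-elim (x∉p[x]≔outside H f (x∈p[y]≔s∧x≢y⇒x∈p inside g∈ g≢e))
  ...   | no g≢f = inj₂ (x∈p[y]≔s∧x≢y⇒x∈p outside (x∈p[y]≔s∧x≢y⇒x∈p inside g∈ g≢e) g≢f , g≢f)

  ∣exchange∣≡∣p∣ : f ∈ H → e ∉ H → ∣ exchange H f e ∣ ≡ ∣ H ∣
  ∣exchange∣≡∣p∣ f∈H e∉H =
    trans (∣p[x]≔inside∣≡1+∣p∣ _ e e∉H[f]≔outside) (1+∣p[x]≔outside∣≡∣p∣ H f f∈H)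
    where
    e∉H[f]≔outside : e ∉ H [ f ]≔ outside
    e∉H[f]≔outside e∈ = e∉H (x∈p[y]≔s∧x≢y⇒x∈p outside e∈ λ { refl → e∉H f∈H })

module _ {n m : ℕ} (G : Graph n m) where

  src dst : Fin m → Fin n
  src e = proj₁ (ends G e)
  dst e = proj₂ (ends G e)

  data Joins (e : Fin m) : Fin n → Fin n → Set where
    forward  : Joins e (src e) (dst e)
    backward : Joins e (dst e) (src e)

  module _ {P : Fin m → Set} where

    reach-trans : ∀ {a b c} → Reach G P a b → Reach G P b c → Reach G P a c
    reach-trans here             b↝c = b↝c
    reach-trans (fwd e Pe eq a↝b) b↝c = fwd e Pe eq (reach-trans a↝b b↝c)
    reach-trans (bwd e Pe eq a↝b) b↝c = bwd e Pe eq (reach-trans a↝b b↝c)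

    joins⇒reach : ∀ {e a b} → Joins e a b → P e → Reach G P a b
    joins⇒reach {e} forward  Pe = fwd e Pe refl here
    joins⇒reach {e} backward Pe = bwd e Pe refl here

    reach-sym : ∀ {a b} → Reach G P a b → Reach G P b a
    reach-sym here                  = here
    reach-sym (fwd e Pe refl a↝b) = reach-trans (reach-sym a↝b) (joins⇒reach backward Pe)
    reach-sym (bwd e Pe refl a↝b) = reach-trans (reach-sym a↝b) (joins⇒reach forward Pe)

  module _ {P Q : Fin m → Set} where

    reach-mono : (∀ {e} → P e → Q e) → ∀ {a b} → Reach G P a b → Reach G Q a b
    reach-mono P⊆Q here             = here
    reach-mono P⊆Q (fwd e Pe eq a↝b) = fwd e (P⊆Q Pe) eq (reach-mono P⊆Q a↝b)
    reach-mono P⊆Q (bwd e Pe eq a↝b) = bwd e (P⊆Q Pe) eq (reach-mono P⊆Q a↝b)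

    reach-restrict : (W : Subset n) →
      (∀ {e a b} → P e → Joins e a b → a ∈ W → b ∈ W × Q e) →
      ∀ {a b} → a ∈ W → Reach G P a b → Reach G Q a b
    reach-restrict W step a∈W here = here
    reach-restrict W step a∈W (fwd e Pe refl a↝b) =
      let b∈W , Qe = step Pe forward a∈W in fwd e Qe refl (reach-restrict W step b∈W a↝b)
    reach-restrict W step a∈W (bwd e Pe refl a↝b) =
      let b∈W , Qe = step Pe backward a∈W in bwd e Qe refl (reach-restrict W step b∈W a↝b)

    reach-bypass : ∀ f → (∀ {e} → P e → e ≢ f → Q e) → Reach G Q (src f) (dst f) →
      ∀ {a b} → Reach G P a b → Reach G Q a b
    reach-bypass f P∖f⊆Q detour here = here
    reach-bypass f P∖f⊆Q detour (fwd e Pe refl a↝b) with e ≟ f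
    ... | yes refl = reach-trans detour (reach-bypass f P∖f⊆Q detour a↝b)
    ... | no e≢f = fwd e (P∖f⊆Q Pe e≢f) refl (reach-bypass f P∖f⊆Q detour a↝b)
    reach-bypass f P∖f⊆Q detour (bwd e Pe refl a↝b) with e ≟ f
    ... | yes refl = reach-trans (reach-sym detour) (reach-bypass f P∖f⊆Q detour a↝b)
    ... | no e≢f = bwd e (P∖f⊆Q Pe e≢f) refl (reach-bypass f P∖f⊆Q detour a↝b)

  Crossing : Subset n → Fin m → Set
  Crossing X e = (src e ∈ X × dst e ∉ X) ⊎ (dst e ∈ X × src e ∉ X)

  crossing? : ∀ X e → Dec (Crossing X e)
  crossing? X e = (src e ∈? X ×-dec ¬? (dst e ∈? X)) ⊎-dec (dst e ∈? X ×-dec ¬? (src e ∈? X))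

  crossing⇒joins : ∀ {X e} → Crossing X e → ∃₂ λ a b → Joins e a b × a ∈ X × b ∉ X
  crossing⇒joins (inj₁ (src∈X , dst∉X)) = _ , _ , forward , src∈X , dst∉X
  crossing⇒joins (inj₂ (dst∈X , src∉X)) = _ , _ , backward , dst∈X , src∉X

  leaving-edge : ∀ {P} X {a b} → Reach G P a b → a ∈ X → b ∉ X → ∃ λ e → P e × Crossing X e
  leaving-edge X here a∈X b∉X = ⊥-elim (b∉X a∈X)
  leaving-edge X (fwd e Pe refl a↝b) a∈X b∉X with dst e ∈? X
  ... | yes dst∈X = leaving-edge X a↝b dst∈X b∉X
  ... | no dst∉X = e , Pe , inj₁ (a∈X , dst∉X)
  leaving-edge X (bwd e Pe refl a↝b) a∈X b∉X with src e ∈? X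
  ... | yes src∈X = leaving-edge X a↝b src∈X b∉X
  ... | no src∉X = e , Pe , inj₂ (a∈X , src∉X)

  ComponentOf : (Fin m → Set) → Fin n → Subset n → Set
  ComponentOf P r C = ∀ v → (v ∈ C → Reach G P r v) × (Reach G P r v → v ∈ C)

  module _ {P : Fin m → Set} (P? : ∀ e → Dec (P e)) (r : Fin n) where

    grow : ∀ k (X : Subset n) → n ∸ ∣ X ∣ ≤ k → r ∈ X → (∀ v → v ∈ X → Reach G P r v) →
      ∃ (ComponentOf P r)
    grow k X missing r∈X X-reached with any? (λ e → P? e ×-dec crossing? X e)
    ... | no no-exit = X , λ v → X-reached v , λ r↝v →
      decidable-stable (v ∈? X) λ v∉X → no-exit (leaving-edge X r↝v r∈X v∉X)
    ... | yes (e , Pe , crosses) with crossing⇒joins crosses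
    ...   | a , b , joins , a∈X , b∉X = grow-by-b k missing
      where
      X⁺ = X [ b ]≔ inside
      ∣X⁺∣≡1+∣X∣ : ∣ X⁺ ∣ ≡ suc ∣ X ∣
      ∣X⁺∣≡1+∣X∣ = ∣p[x]≔inside∣≡1+∣p∣ X b b∉X
      ∣X∣<n : ∣ X ∣ < n
      ∣X∣<n = subst (_≤ n) ∣X⁺∣≡1+∣X∣ (∣p∣≤n X⁺)
      X⁺-reached : ∀ v → v ∈ X⁺ → Reach G P r v
      X⁺-reached v v∈ with v ≟ b
      ... | yes refl = reach-trans (X-reached a a∈X) (joins⇒reach joins Pe)
      ... | no v≢b = X-reached v (x∈p[y]≔s∧x≢y⇒x∈p inside v∈ v≢b)
      grow-by-b : ∀ k → n ∸ ∣ X ∣ ≤ k → ∃ (ComponentOf P r)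
      grow-by-b zero    missing = ⊥-elim (<⇒≱ (m<n⇒0<n∸m ∣X∣<n) missing)
      grow-by-b (suc k) missing =
        grow k X⁺ (≤-pred (subst (λ s → suc (n ∸ s) ≤ suc k) (sym ∣X⁺∣≡1+∣X∣)
                             (<-≤-trans (∸-monoʳ-< (n<1+n _) ∣X∣<n) missing)))
             (x∈p∧x≢y⇒x∈p[y]≔s inside r∈X λ { refl → b∉X r∈X }) X⁺-reached

    component : ∃ (ComponentOf P r)
    component = grow n ⁅ r ⁆ (m∸n≤m n ∣ ⁅ r ⁆ ∣) (x∈⁅x⁆ r)
      (λ v v∈⁅r⁆ → subst (Reach G P r) (sym (x∈⁅y⁆⇒x≡y r v∈⁅r⁆)) here)

  module _ {S : Subset m} {r : Fin n} {C : Subset n} (C-comp : ComponentOf (InS G S) r C) where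

    root∈component : r ∈ C
    root∈component = proj₂ (C-comp r) here

    component-closed : ∀ {e a b} → e ∈ S → Joins e a b → a ∈ C → b ∈ C
    component-closed e∈S joins a∈C =
      proj₂ (C-comp _) (reach-trans (proj₁ (C-comp _) a∈C) (joins⇒reach joins e∈S))

    ¬reach⇒outside-component : ∀ {u v} → ¬ Reach G (InS G S) u v → ∃ λ w → w ∉ C
    ¬reach⇒outside-component {u} {v} u↛v with u ∈? C | v ∈? C
    ... | no u∉C | _       = u , u∉C
    ... | yes _  | no v∉C  = v , v∉C
    ... | yes u∈C | yes v∈C =
      ⊥-elim (u↛v (reach-trans (reach-sym (proj₁ (C-comp u) u∈C)) (proj₁ (C-comp v) v∈C)))

    ⊂-component : ∀ {D e a b} → (∀ x → x ∈ D → Reach G (InS G S) r x) →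
      e ∈ S → Joins e a b → a ∈ D → b ∉ D → D ⊂ C
    ⊂-component D-reached e∈S joins a∈D b∉D =
      (λ {x} x∈D → proj₂ (C-comp x) (D-reached x x∈D)) ,
      _ , proj₂ (C-comp _) (reach-trans (D-reached _ a∈D) (joins⇒reach joins e∈S)) , b∉D

    ¬spanning-without⇒bridge : ∀ {f} → f ∈ S →
      ¬ (∀ x → x ∈ C → Reach G (λ g → g ∈ S × g ≢ f) r x) → HasBridge G S C
    ¬spanning-without⇒bridge {f} f∈S ¬spanning with src f ∈? C
    ... | no src∉C = ⊥-elim (¬spanning λ x x∈C →
      reach-restrict C avoids-f root∈component (proj₁ (C-comp x) x∈C))
      where
      src∈ : ∀ {g a b} → Joins g a b → a ∈ C → b ∈ C → src g ∈ C
      src∈ forward  a∈C _   = a∈C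
      src∈ backward _   b∈C = b∈C
      avoids-f : ∀ {g a b} → g ∈ S → Joins g a b → a ∈ C → b ∈ C × (g ∈ S × g ≢ f)
      avoids-f g∈S joins a∈C =
        let b∈C = component-closed g∈S joins a∈C in
        b∈C , g∈S , λ { refl → src∉C (src∈ joins a∈C b∈C) }
    ... | yes src∈C = f , f∈S , src∈C , dst∈C , src f , dst f , src∈C , dst∈C , λ detour →
      ¬spanning λ x x∈C → reach-bypass f _,_ detour (proj₁ (C-comp x) x∈C)
      where
      dst∈C : dst f ∈ C
      dst∈C = component-closed f∈S forward src∈C

  module _ {t} {c : Fin m → Fin t} {H : Subset m} (H-rep : IsRepresenting G c H) where

    representing⇒all-colours : ∀ j → ∃ λ e → e ∈ H × c e ≡ j
    representing⇒all-colours j =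
      let I , I⊆c[H] , ∣I∣≡∣H∣ = injective-image c H (proj₂ H-rep) in
      I⊆c[H] (subst (j ∈_) (sym (∣p∣≡n⇒p≡⊤ (trans ∣I∣≡∣H∣ (proj₁ H-rep)))) ∈⊤)

    exchange-representing : ∀ {f e} → f ∈ H → e ∉ H → c e ≡ c f →
      IsRepresenting G c (exchange H f e)
    exchange-representing {f} {e} f∈H e∉H ce≡cf =
      trans (∣exchange∣≡∣p∣ f∈H e∉H) (proj₁ H-rep) , injective
      where
      inj = proj₂ H-rep
      injective : InjectiveOn c (exchange H f e)
      injective g h g∈ h∈ cg≡ch with ∈-exchange⁻ g∈ | ∈-exchange⁻ h∈
      ... | inj₁ g≡e         | inj₁ h≡e         = trans g≡e (sym h≡e)
      ... | inj₁ refl        | inj₂ (h∈H , h≢f) = ⊥-elim (h≢f (sym (inj f h f∈H h∈H (trans (sym ce≡cf) cg≡ch))))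
      ... | inj₂ (g∈H , g≢f) | inj₁ refl        = ⊥-elim (g≢f (inj g f g∈H f∈H (trans cg≡ch ce≡cf)))
      ... | inj₂ (g∈H , _)   | inj₂ (h∈H , _)   = inj g h g∈H h∈H cg≡ch

lemma2p2 : {n m t : ℕ} (G : Graph n m) (c : Fin m → Fin t) →
    Connected G → IsEdgeColoring G t c →
    (H : Subset m) → IsRepresenting G c H →
    (H₁ : Subset n) → IsComponent G H H₁ →
    (∀ (H' : Subset m) → IsRepresenting G c H' →
    ∀ (C' : Subset n) → IsComponent G H' C' → ∣ C' ∣ ≤ ∣ H₁ ∣) →
    AtLeastTwoComponents G H →
    HasBridge G H H₁
lemma2p2 G c connected _ H H-rep H₁ (r , H₁-comp) maximal (_ , _ , u↛v)
  with ¬reach⇒outside-component G H₁-comp u↛v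
... | w , w∉H₁ with leaving-edge G H₁ (connected r w) (root∈component G H₁-comp) w∉H₁
... | e , _ , crosses with crossing⇒joins G crosses
... | a , b , joins , a∈H₁ , b∉H₁ with representing⇒all-colours G H-rep (c e)
... | f , f∈H , cf≡ce with component G (_∈? exchange H f e) r
... | C' , C'-comp =
  ¬spanning-without⇒bridge G H₁-comp f∈H λ spanning →
    <⇒≱ (p⊂q⇒∣p∣<∣q∣ (⊂-component G C'-comp
                          (λ x x∈H₁ → reach-mono G ∈-exchange⁺ (spanning x x∈H₁))
                          e∈exchange joins a∈H₁ b∉H₁))
        (maximal _ (exchange-representing G H-rep f∈H e∉H (sym cf≡ce)) C' (r , C'-comp))
  where
  e∉H : e ∉ H
  e∉H e∈H = b∉H₁ (component-closed G H₁-comp e∈H joins a∈H₁)
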